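{- If $M$ is an MA-presented $\mathcal L$-structure, then a map $f:M\to M$ is an automorphism of $M$ if and only if it is an $\mathcal L$-component map.
   Context: Languages have only relation and constant symbols. A relation is mutually algebraic if there is $K$ such that each element occurs in at most $K$ of its tuples; $M$ is MA-presented if every atomic $\mathcal L$-formula defines a mutually algebraic relation. $b$ is a mate of $a$ if some atomic formula holds on a tuple (in some order) containing $a$ and $b$; $\sim$ is the transitive closure of the mate relation, $[a]_\sim$ the class of $a$. A component map is a bijection $f:M\to M$ with $f([a]_\sim)=[f(a)]_\sim$ setwise for all $a$; an $\mathcal L$-component map is a component map such that for each $a$, $f\restriction[a]_\sim:[a]_\sim\to[f(a)]_\sim$ is an $\mathcal L$-isomorphism. -}

module Defs where

open import Data.Nat using (ℕ; _≤_)
open import Data.Fin using (Fin)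
open import Data.Vec using (Vec; map)
import Data.Vec
import Data.Vec.Relation.Unary.All
open import Data.Vec.Membership.Propositional using (_∈_)
open import Data.Vec.Relation.Unary.Any using (Any)
open import Data.List using (List; length)
open import Data.List.Relation.Unary.All using (All)
open import Data.List.Relation.Unary.Unique.Propositional using (Unique)
open import Data.Product using (Σ; ∃; _×_; _,_)
open import Data.Sum using (_⊎_)
open import Function.Bundles using (_⇔_)
open import Function.Definitions using (Bijective)
open import Relation.Binary.PropositionalEquality using (_≡_)
open import Relation.Binary.Construct.Closure.ReflexiveTransitive using (Star)

record Language : Set₁ where
  field
    Rel   : Set
    arity : Rel → ℕ
    Const : Set
open Language public

record Structure (L : Language) : Set₁ where
  field
    Carrier : Set
    relI    : (R : Rel L) → Vec Carrier (arity L R) → Set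
    constI  : Const L → Carrier
open Structure public

data Term (L : Language) (k : ℕ) : Set where
  var   : Fin k → Term L k
  const : Const L → Term L k

data Atomic (L : Language) (k : ℕ) : Set where
  rel : (R : Rel L) → Vec (Term L k) (arity L R) → Atomic L k
  eq  : Term L k → Term L k → Atomic L k

Occurs : {L : Language} {k : ℕ} → Fin k → Atomic L k → Set
Occurs i (rel R ts) = Any (λ t → t ≡ var i) ts
Occurs i (eq t u)   = (t ≡ var i) ⊎ (u ≡ var i)

-- the listed variables are exactly the free variables of φ
AllVarsOccur : {L : Language} {k : ℕ} → Atomic L k → Set
AllVarsOccur {k = k} φ = (i : Fin k) → Occurs i φ

module _ {L : Language} (M : Structure L) where

  evalT : {k : ℕ} → Vec (Carrier M) k → Term L k → Carrier M
  evalT v (var i)   = Data.Vec.lookup v i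
  evalT v (const c) = constI M c

  Holds : {k : ℕ} → Atomic L k → Vec (Carrier M) k → Set
  Holds (rel R ts) v = relI M R (map (evalT v) ts)
  Holds (eq t u)   v = evalT v t ≡ evalT v u

  -- A relation X ⊆ M^k is mutually algebraic: there is K such that every
  -- element occurs in at most K tuples of X (any list of distinct tuples of X
  -- containing a has length ≤ K).
  MutuallyAlgebraic : {k : ℕ} → (Vec (Carrier M) k → Set) → Set
  MutuallyAlgebraic {k} X =
    Σ ℕ λ K → (a : Carrier M) (ts : List (Vec (Carrier M) k)) →
      Unique ts → All (λ t → X t × a ∈ t) ts → length ts ≤ K

  MAPresented : Set
  MAPresented = (k : ℕ) (φ : Atomic L k) → AllVarsOccur φ → MutuallyAlgebraic (Holds φ)

  Mate : Carrier M → Carrier M → Set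
  Mate a b = Σ ℕ λ k → Σ (Atomic L k) λ φ → AllVarsOccur φ ×
             Σ (Vec (Carrier M) k) λ c → Holds φ c × a ∈ c × b ∈ c

  _∼_ : Carrier M → Carrier M → Set
  _∼_ = Star Mate

  -- f([a]∼) = [f(a)]∼ setwise
  MapsClassOnto : (Carrier M → Carrier M) → Carrier M → Set
  MapsClassOnto f a =
    ((b : Carrier M) → a ∼ b → f a ∼ f b) ×
    ((c : Carrier M) → f a ∼ c → ∃ λ b → a ∼ b × f b ≡ c)

  ComponentMap : (Carrier M → Carrier M) → Set
  ComponentMap f = Bijective _≡_ _≡_ f × ((a : Carrier M) → MapsClassOnto f a)

  -- f ↾ [a]∼ : [a]∼ → [f a]∼ is an L-isomorphism (a bijection, by the component
  -- map condition, preserving and reflecting all atomic formulas on tuples from [a]∼)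
  LIsoOnClass : (Carrier M → Carrier M) → Carrier M → Set
  LIsoOnClass f a = (k : ℕ) (φ : Atomic L k) (c : Vec (Carrier M) k) →
    Data.Vec.Relation.Unary.All.All (λ x → a ∼ x) c → Holds φ c ⇔ Holds φ (map f c)

  LComponentMap : (Carrier M → Carrier M) → Set
  LComponentMap f = ComponentMap f × ((a : Carrier M) → LIsoOnClass f a)

  Automorphism : (Carrier M → Carrier M) → Set
  Automorphism f = Bijective _≡_ _≡_ f ×
    ((c : Const L) → f (constI M c) ≡ constI M c) ×
    ((R : Rel L) (v : Vec (Carrier M) (arity L R)) → relI M R v ⇔ relI M R (map f v))

module Submission where

-- The pivot is the notion "f preserves and reflects the atomic formula φ"
-- (on every tuple).  The two directions of the theorem are:
--
--  * An automorphism preserves and reflects every atomic formula.  Any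
--    bijection with that property maps mates to mates, and so does its
--    inverse; hence it maps each ∼-class onto the class of the image, i.e. it
--    is a component map, and it is an L-isomorphism on every class.
--
--  * Conversely, a tuple satisfying an atomic formula in which every variable
--    occurs consists of pairwise mates, so it lies inside one ∼-class.  A
--    component map also reflects ∼, so an L-component map preserves and
--    reflects all such formulas.  Constants and relations are expressed by
--    formulas of this kind, so an L-component map is an automorphism.

open import Defs
open import Data.Fin using (Fin; zero)
open import Data.Vec using (Vec; []; _∷_; map; tabulate)
open import Data.Vec.Properties using (tabulate-∘; tabulate∘lookup; lookup-map; map-∘; map-cong; map-id)
open import Data.Vec.Membership.Propositional using (_∈_)
open import Data.Vec.Membership.Propositional.Properties using (∈-map⁺)
open import Data.Vec.Relation.Unary.Any using (here; there)
import Data.Vec.Relation.Unary.Any.Properties as Any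
open import Data.Vec.Relation.Unary.All using (All; []; _∷_) renaming (map to mapAll)
import Data.Vec.Relation.Unary.All.Properties as All
open import Data.Nat using (ℕ)
open import Data.Product using (_,_; proj₁; proj₂)
open import Data.Sum using (inj₁)
open import Function using (id)
open import Function.Bundles using (_⇔_; mk⇔; Equivalence)
open import Function.Definitions using (Bijective)
open import Relation.Binary.PropositionalEquality
  using (_≡_; refl; sym; trans; cong; subst)
open import Relation.Binary.Construct.Closure.ReflexiveTransitive using (ε; _◅_)

All-fromMembers : {A : Set} {P : A → Set} {n : ℕ} (v : Vec A n) →
                  (∀ {y} → y ∈ v → P y) → All P v
All-fromMembers []      P∈ = []
All-fromMembers (x ∷ v) P∈ = P∈ (here refl) ∷ All-fromMembers v (λ y∈v → P∈ (there y∈v))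

module Inverse {A : Set} (f : A → A) (bij : Bijective _≡_ _≡_ f) where

  inv : A → A
  inv y = proj₁ (proj₂ bij y)

  section : ∀ y → f (inv y) ≡ y
  section y = proj₂ (proj₂ bij y) refl

  retraction : ∀ x → inv (f x) ≡ x
  retraction x = proj₁ bij (section (f x))

module _ {L : Language} (M : Structure L) where

  private
    C : Set
    C = Carrier M

  Preserves : (C → C) → {k : ℕ} → Atomic L k → Set
  Preserves f φ = (c : Vec C _) → Holds M φ c ⇔ Holds M φ (map f c)

  relFormula : (R : Rel L) → Atomic L (arity L R)
  relFormula R = rel R (tabulate var)

  relFormula-allVars : (R : Rel L) → AllVarsOccur (relFormula R)
  relFormula-allVars R i = Any.tabulate⁺ i refl

  holds-relFormula : (R : Rel L) (v : Vec C (arity L R)) →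
                     Holds M (relFormula R) v ≡ relI M R v
  holds-relFormula R v = cong (relI M R) (trans (sym (tabulate-∘ (evalT M v) var)) (tabulate∘lookup v))

  constFormula : Const L → Atomic L 1
  constFormula c = eq (var zero) (const c)

  constFormula-allVars : (c : Const L) → AllVarsOccur (constFormula c)
  constFormula-allVars c zero = inj₁ refl

  fixes-const : (f : C → C) (c : Const L) → Preserves f (constFormula c) →
                f (constI M c) ≡ constI M c
  fixes-const f c pres = Equivalence.to (pres (constI M c ∷ [])) refl

  preserves-rel : (f : C → C) (R : Rel L) → Preserves f (relFormula R) →
                  (v : Vec C (arity L R)) → relI M R v ⇔ relI M R (map f v)
  preserves-rel f R pres v =
    subst (λ P → P ⇔ relI M R (map f v)) (holds-relFormula R v)
      (subst (Holds M (relFormula R) v ⇔_) (holds-relFormula R (map f v)) (pres v))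

  -- Automorphisms commute with the evaluation of terms, hence preserve and
  -- reflect every atomic formula.
  module _ (f : C → C) (aut : Automorphism M f) where

    private
      f-injective : ∀ {x y} → f x ≡ f y → x ≡ y
      f-injective = proj₁ (proj₁ aut)

      f-fixes : (d : Const L) → f (constI M d) ≡ constI M d
      f-fixes = proj₁ (proj₂ aut)

      f-rel : (R : Rel L) (v : Vec C (arity L R)) → relI M R v ⇔ relI M R (map f v)
      f-rel = proj₂ (proj₂ aut)

    evalT-map : {k : ℕ} (c : Vec C k) (t : Term L k) → evalT M (map f c) t ≡ f (evalT M c t)
    evalT-map c (var i)   = lookup-map i f c
    evalT-map c (const d) = sym (f-fixes d)

    evalTs-map : {k n : ℕ} (c : Vec C k) (ts : Vec (Term L k) n) →
                 map (evalT M (map f c)) ts ≡ map f (map (evalT M c) ts)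
    evalTs-map c ts = trans (map-cong (evalT-map c) ts) (map-∘ f (evalT M c) ts)

    automorphism-preserves : {k : ℕ} (φ : Atomic L k) → Preserves f φ
    automorphism-preserves (rel R ts) c =
      subst (relI M R (map (evalT M c) ts) ⇔_) (cong (relI M R) (sym (evalTs-map c ts)))
        (f-rel R (map (evalT M c) ts))
    automorphism-preserves (eq t u) c = mk⇔
      (λ t≡u → trans (evalT-map c t) (trans (cong f t≡u) (sym (evalT-map c u))))
      (λ ft≡fu → f-injective (trans (sym (evalT-map c t)) (trans ft≡fu (evalT-map c u))))

  module _ (f : C → C) (pres : ∀ {k} (φ : Atomic L k) → Preserves f φ) where

    preserves-mate : ∀ {a b} → Mate M a b → Mate M (f a) (f b)
    preserves-mate (k , φ , occ , c , φc , a∈c , b∈c) =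
      k , φ , occ , map f c , Equivalence.to (pres φ c) φc , ∈-map⁺ f a∈c , ∈-map⁺ f b∈c

    preserves-∼ : ∀ {a b} → _∼_ M a b → _∼_ M (f a) (f b)
    preserves-∼ ε       = ε
    preserves-∼ (m ◅ s) = preserves-mate m ◅ preserves-∼ s

  section-preserves : (f g : C → C) → (∀ y → f (g y) ≡ y) →
                      {k : ℕ} (φ : Atomic L k) → Preserves f φ → Preserves g φ
  section-preserves f g fg φ pres c = mk⇔
    (λ φc → Equivalence.from (pres (map g c)) (subst (Holds M φ) (sym fg-c) φc))
    (λ φgc → subst (Holds M φ) fg-c (Equivalence.to (pres (map g c)) φgc))
    where
    fg-c : map f (map g c) ≡ c
    fg-c = trans (sym (map-∘ f g c)) (trans (map-cong fg c) (map-id c))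

  preserving-bijection-isComponentMap :
    (f : C → C) (bij : Bijective _≡_ _≡_ f) →
    (∀ {k} (φ : Atomic L k) → Preserves f φ) → ComponentMap M f
  preserving-bijection-isComponentMap f bij pres = bij , λ a →
    (λ b → preserves-∼ f pres) ,
    (λ d fa∼d → inv d , a∼inv d fa∼d , section d)
    where
    open Inverse f bij
    inv-pres : ∀ {k} (φ : Atomic L k) → Preserves inv φ
    inv-pres φ = section-preserves f inv section φ (pres φ)

    a∼inv : ∀ {a} d → _∼_ M (f a) d → _∼_ M a (inv d)
    a∼inv {a} d fa∼d = subst (λ x → _∼_ M x (inv d)) (retraction a) (preserves-∼ inv inv-pres fa∼d)

  satisfying-tuple-in-class : {k : ℕ} (φ : Atomic L k) → AllVarsOccur φ →
                              (c : Vec C k) → Holds M φ c → ∀ {x} → x ∈ c → All (_∼_ M x) c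
  satisfying-tuple-in-class φ occ c φc x∈c =
    All-fromMembers c (λ y∈c → (_ , φ , occ , c , φc , x∈c , y∈c) ◅ ε)

  componentMap-reflects-∼ : (f : C → C) → ComponentMap M f →
                            ∀ {a b} → _∼_ M (f a) (f b) → _∼_ M a b
  componentMap-reflects-∼ f (bij , onto) {a} fa∼fb with proj₂ (onto a) _ fa∼fb
  ... | d , a∼d , fd≡fb = subst (_∼_ M a) (proj₁ bij fd≡fb) a∼d

  lComponentMap-preserves : (f : C → C) → LComponentMap M f →
                            {k : ℕ} (φ : Atomic L k) → AllVarsOccur φ → Preserves f φ
  lComponentMap-preserves f lcm φ occ []      = mk⇔ id id
  lComponentMap-preserves f (cm , iso) φ occ (x ∷ c) = mk⇔
    (λ φxc → Equivalence.to (iso x _ φ (x ∷ c) (inClass φxc)) φxc)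
    (λ φfxc → Equivalence.from (iso x _ φ (x ∷ c) (inClassᶠ φfxc)) φfxc)
    where
    inClass : Holds M φ (x ∷ c) → All (_∼_ M x) (x ∷ c)
    inClass φxc = satisfying-tuple-in-class φ occ (x ∷ c) φxc (here refl)

    inClassᶠ : Holds M φ (map f (x ∷ c)) → All (_∼_ M x) (x ∷ c)
    inClassᶠ φfxc = mapAll (componentMap-reflects-∼ f cm)
      (All.map⁻ (satisfying-tuple-in-class φ occ (map f (x ∷ c)) φfxc (here refl)))

  -- Forward direction: an automorphism is a component map, and an
  -- L-isomorphism on each class because it preserves every atomic formula.
  automorphism⇒lComponentMap : (f : C → C) → Automorphism M f → LComponentMap M f
  automorphism⇒lComponentMap f aut =
    preserving-bijection-isComponentMap f (proj₁ aut) pres , λ a k φ c _ → pres φ c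
    where
    pres : ∀ {k} (φ : Atomic L k) → Preserves f φ
    pres = automorphism-preserves f aut

  -- Backward direction: constants and relations are defined by atomic
  -- formulas in which every variable occurs.
  lComponentMap⇒automorphism : (f : C → C) → LComponentMap M f → Automorphism M f
  lComponentMap⇒automorphism f lcm =
    proj₁ (proj₁ lcm) ,
    (λ c → fixes-const f c (pres (constFormula c) (constFormula-allVars c))) ,
    (λ R → preserves-rel f R (pres (relFormula R) (relFormula-allVars R)))
    where
    pres : ∀ {k} (φ : Atomic L k) → AllVarsOccur φ → Preserves f φ
    pres = lComponentMap-preserves f lcm

lemma1 : {L : Language} (M : Structure L) → MAPresented M →
    (f : Carrier M → Carrier M) → Automorphism M f ⇔ LComponentMap M f
lemma1 M _ f = mk⇔ (automorphism⇒lComponentMap M f) (lComponentMap⇒automorphism M f)
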